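{- Let $q<p$ be positive integers and let $g=\gcd(p,q)$. Let $\sim$ be the equivalence relation on $\mathbb{Z}$ generated by: $x\sim y$ whenever $x\equiv y\pmod q$; $x\sim q-1-x$ for $x\in\{0,\ldots,q-1\}$; and $x\sim p-1-x$ for $x\in\{0,\ldots,p-1\}$. Then $x\sim y$ if and only if $x\equiv y\pmod g$ or $x+y\equiv-1\pmod g$. -}

module Defs where

open import Data.Nat using (ℕ)
open import Data.Integer using (ℤ; +_; _+_; _-_; -_; _≤_; _<_; 0ℤ; 1ℤ)
open import Data.Integer.Divisibility using (_∣_)

_≡_[mod_] : ℤ → ℤ → ℕ → Set
x ≡ y [mod m ] = (+ m) ∣ (x - y)

data _~⟨_,_⟩_ : ℤ → ℕ → ℕ → ℤ → Set where
  gen-mod  : ∀ {p q x y} → x ≡ y [mod q ] → x ~⟨ p , q ⟩ y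
  gen-refq : ∀ {p q x} → 0ℤ ≤ x → x < + q → x ~⟨ p , q ⟩ ((+ q - 1ℤ) - x)
  gen-refp : ∀ {p q x} → 0ℤ ≤ x → x < + p → x ~⟨ p , q ⟩ ((+ p - 1ℤ) - x)
  ~-refl   : ∀ {p q x} → x ~⟨ p , q ⟩ x
  ~-sym    : ∀ {p q x y} → x ~⟨ p , q ⟩ y → y ~⟨ p , q ⟩ x
  ~-trans  : ∀ {p q x y z} → x ~⟨ p , q ⟩ y → y ~⟨ p , q ⟩ z → x ~⟨ p , q ⟩ z

-- Since ~ is an equivalence relation, its periods (the t with x ~ x + t for all x)
-- form a subgroup of ℤ.  It contains q, and also p - q: the reflections
-- x ↦ (q - 1) - x and x ↦ (p - 1) - x relate every x to its image, because they
-- commute with reduction mod q and the generators give them on the residues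
-- 0, …, q - 1 < p; their composite is the translation by p - q.  Hence g = gcd p q is
-- a period, and one reflection then relates x and y whenever x + y ≡ -1 (mod g).
-- Conversely, congruence mod g up to x ↦ -1 - x is an equivalence relation
-- containing the generators, because g divides p and q.
module Submission where

open import Defs
import Data.Nat as ℕ
open import Data.Nat using (ℕ; z≤n; NonZero; >-nonZero) renaming (_<_ to _<ℕ_)
open import Data.Nat.Divisibility using (∣-trans) renaming (_∣_ to _∣ℕ_)
open import Data.Nat.GCD using (gcd; gcd[m,n]∣m; gcd[m,n]∣n; gcd-GCD; module Bézout)
open import Data.Integer using (ℤ; +_; -[1+_]; _+_; _-_; -_; _*_; 0ℤ; 1ℤ; _≤_; _<_; +≤+; +<+)
open import Data.Integer.Properties
  using (+-comm; +-identityʳ; +-assoc; +-minus-telescope; *-zeroˡ; suc-*; neg-distribˡ-*; pos-+; pos-*; <-trans)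
open import Data.Integer.DivMod using (_%ℕ_; _/ℕ_; n%ℕd<d; a≡a%ℕn+[a/ℕn]*n)
open import Data.Integer.Divisibility using (_∣_)
import Data.Integer.Divisibility.Signed as Signed
open import Data.Integer.Tactic.RingSolver using (solve-∀)
open import Data.Sum using (_⊎_; inj₁; inj₂)
open import Function.Bundles using (_⇔_; mk⇔)
open import Level using (0ℓ)
open import Relation.Binary.Core using (Rel)
open import Relation.Binary.Structures using (IsEquivalence)
open import Relation.Binary.PropositionalEquality using (_≡_; sym; cong; subst; module ≡-Reasoning)

private
  variable
    m n : ℕ

-- x ≡ y [mod m] unfolds to a statement about ∣ x - y ∣, from which Agda cannot
-- recover x and y, so the congruence lemmas take them explicitly.

≡-mod-by-difference : ∀ x y u v → x - y ≡ u - v → x ≡ y [mod m ] → u ≡ v [mod m ]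
≡-mod-by-difference {m} _ _ _ _ eq = subst (+ m ∣_) eq

≡-mod-by-multiple : ∀ x y k → x - y ≡ k * + m → x ≡ y [mod m ]
≡-mod-by-multiple x y k eq = Signed.∣⇒∣ᵤ {i = x - y} (Signed.divides k eq)

≡-mod⇒∣ : ∀ x y → x ≡ y [mod m ] → + m Signed.∣ (x - y)
≡-mod⇒∣ x y = Signed.∣ᵤ⇒∣ {i = x - y}

≡-mod-refl : ∀ x → x ≡ x [mod m ]
≡-mod-refl {m} x = ≡-mod-by-multiple x x 0ℤ (x-x≡0*m x (+ m))
  where
  x-x≡0*m : ∀ x m → x - x ≡ 0ℤ * m
  x-x≡0*m = solve-∀

≡-mod-sym : ∀ x y → x ≡ y [mod m ] → y ≡ x [mod m ]
≡-mod-sym x y x≡y =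
  Signed.∣⇒∣ᵤ (subst (_ Signed.∣_) (-[x-y]≡y-x x y) (Signed.∣m⇒∣-m (≡-mod⇒∣ x y x≡y)))
  where
  -[x-y]≡y-x : ∀ x y → - (x - y) ≡ y - x
  -[x-y]≡y-x = solve-∀

≡-mod-trans : ∀ x y z → x ≡ y [mod m ] → y ≡ z [mod m ] → x ≡ z [mod m ]
≡-mod-trans x y z x≡y y≡z = Signed.∣⇒∣ᵤ (subst (_ Signed.∣_) (+-minus-telescope x y z)
  (Signed.∣m∣n⇒∣m+n (≡-mod⇒∣ x y x≡y) (≡-mod⇒∣ y z y≡z)))

[x+z]-[y+z]≡x-y : ∀ x y z → (x + z) - (y + z) ≡ x - y
[x+z]-[y+z]≡x-y = solve-∀

≡-mod-+ʳ : ∀ x y z → x ≡ y [mod m ] → (x + z) ≡ (y + z) [mod m ]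
≡-mod-+ʳ x y z = ≡-mod-by-difference x y (x + z) (y + z) (sym ([x+z]-[y+z]≡x-y x y z))

≡-mod-cancelʳ : ∀ x y z → (x + z) ≡ (y + z) [mod m ] → x ≡ y [mod m ]
≡-mod-cancelʳ x y z = ≡-mod-by-difference (x + z) (y + z) x y ([x+z]-[y+z]≡x-y x y z)

≡-mod-weaken : ∀ x y → m ∣ℕ n → x ≡ y [mod n ] → x ≡ y [mod m ]
≡-mod-weaken _ _ = ∣-trans

≡-mod-residue : ∀ x → .{{_ : NonZero m}} → x ≡ + (x %ℕ m) [mod m ]
≡-mod-residue {m} x = ≡-mod-by-multiple x r (x /ℕ m) (begin
  x - r                        ≡⟨ cong (_- r) (a≡a%ℕn+[a/ℕn]*n x m) ⟩
  (r + (x /ℕ m) * + m) - r     ≡⟨ [r+k]-r≡k r _ ⟩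
  (x /ℕ m) * + m               ∎)
  where
  open ≡-Reasoning
  r : ℤ
  r = + (x %ℕ m)
  [r+k]-r≡k : ∀ r k → (r + k) - r ≡ k
  [r+k]-r≡k = solve-∀

reflection-sum : m ∣ℕ n → ∀ x → (x + ((+ n - 1ℤ) - x)) ≡ - 1ℤ [mod m ]
reflection-sum {m} {n} m∣n x = subst (+ m ∣_) (sym ([x+[[n-1]-x]]+1≡n (+ n) x)) m∣n
  where
  [x+[[n-1]-x]]+1≡n : ∀ n x → (x + ((n - 1ℤ) - x)) - - 1ℤ ≡ n
  [x+[[n-1]-x]]+1≡n = solve-∀

_≡±_[mod_] : ℤ → ℤ → ℕ → Set
x ≡± y [mod m ] = x ≡ y [mod m ] ⊎ (x + y) ≡ - 1ℤ [mod m ]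

reflected-sym : ∀ x y → (x + y) ≡ - 1ℤ [mod m ] → (y + x) ≡ - 1ℤ [mod m ]
reflected-sym {m} x y = subst (λ s → s ≡ - 1ℤ [mod m ]) (+-comm x y)

reflected-trans : ∀ x y z → (x + y) ≡ - 1ℤ [mod m ] → (y + z) ≡ - 1ℤ [mod m ] →
                  x ≡ z [mod m ]
reflected-trans x y z x+y≡-1 y+z≡-1 = ≡-mod-cancelʳ x z y (≡-mod-trans (x + y) (- 1ℤ) (z + y)
  x+y≡-1 (≡-mod-sym (z + y) (- 1ℤ) (reflected-sym y z y+z≡-1)))

≡±-isEquivalence : IsEquivalence (λ x y → x ≡± y [mod m ])
≡±-isEquivalence = record
  { refl  = λ {x} → inj₁ (≡-mod-refl x)
  ; sym   = λ {x} {y} → λ where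
      (inj₁ x≡y)    → inj₁ (≡-mod-sym x y x≡y)
      (inj₂ x+y≡-1) → inj₂ (reflected-sym x y x+y≡-1)
  ; trans = λ {x} {y} {z} → λ where
      (inj₁ x≡y)    (inj₁ y≡z)    → inj₁ (≡-mod-trans x y z x≡y y≡z)
      (inj₁ x≡y)    (inj₂ y+z≡-1) → inj₂
        (≡-mod-trans (x + z) (y + z) (- 1ℤ) (≡-mod-+ʳ x y z x≡y) y+z≡-1)
      (inj₂ x+y≡-1) (inj₁ y≡z)    → inj₂ (reflected-sym z x (≡-mod-trans (z + x) (y + x) (- 1ℤ)
        (≡-mod-+ʳ z y x (≡-mod-sym y z y≡z)) (reflected-sym x y x+y≡-1)))
      (inj₂ x+y≡-1) (inj₂ y+z≡-1) → inj₁ (reflected-trans x y z x+y≡-1 y+z≡-1)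
  }

module _ {ℓ} {p q : ℕ} {R : Rel ℤ ℓ} (R-isEquivalence : IsEquivalence R) where
  private module R = IsEquivalence R-isEquivalence

  ~-least : (∀ x y → x ≡ y [mod q ] → R x y) →
            (∀ x → 0ℤ ≤ x → x < + q → R x ((+ q - 1ℤ) - x)) →
            (∀ x → 0ℤ ≤ x → x < + p → R x ((+ p - 1ℤ) - x)) →
            ∀ {x y} → x ~⟨ p , q ⟩ y → R x y
  ~-least R-mod R-refq R-refp = go
    where
    go : ∀ {x y} → x ~⟨ p , q ⟩ y → R x y
    go {x} {y} (gen-mod x≡y)       = R-mod x y x≡y
    go {x}     (gen-refq 0≤x x<q)  = R-refq x 0≤x x<q
    go {x}     (gen-refp 0≤x x<p)  = R-refp x 0≤x x<p
    go         ~-refl              = R.refl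
    go         (~-sym x~y)         = R.sym (go x~y)
    go         (~-trans x~y y~z)   = R.trans (go x~y) (go y~z)

~⇒≡± : ∀ {p q x y} → m ∣ℕ p → m ∣ℕ q → x ~⟨ p , q ⟩ y → x ≡± y [mod m ]
~⇒≡± m∣p m∣q = ~-least ≡±-isEquivalence
  (λ x y x≡y → inj₁ (≡-mod-weaken x y m∣q x≡y))
  (λ x _ _ → inj₂ (reflection-sum m∣q x))
  (λ x _ _ → inj₂ (reflection-sum m∣p x))

~-isEquivalence : ∀ {p q} → IsEquivalence (λ x y → x ~⟨ p , q ⟩ y)
~-isEquivalence = record { refl = ~-refl ; sym = ~-sym ; trans = ~-trans }

Period : ∀ {ℓ} → Rel ℤ ℓ → ℤ → Set ℓ
Period _≈_ t = ∀ x → x ≈ (x + t)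

record IsSubgroup {ℓ} (P : ℤ → Set ℓ) : Set ℓ where
  field
    contains-0 : P 0ℤ
    +-closed   : ∀ {s t} → P s → P t → P (s + t)
    neg-closed : ∀ {t} → P t → P (- t)

periods-isSubgroup : ∀ {ℓ} {_≈_ : Rel ℤ ℓ} → IsEquivalence _≈_ → IsSubgroup (Period _≈_)
periods-isSubgroup {_≈_ = _≈_} ≈-isEquivalence = record
  { contains-0 = λ x → ≈.reflexive (sym (+-identityʳ x))
  ; +-closed   = λ {s} {t} s-period t-period x →
      ≈.trans (s-period x) (subst ((x + s) ≈_) (+-assoc x s t) (t-period (x + s)))
  ; neg-closed = λ {t} t-period x →
      ≈.sym (subst ((x + - t) ≈_) ([x-t]+t≡x x t) (t-period (x + - t)))
  }
  where
  module ≈ = IsEquivalence ≈-isEquivalence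
  [x-t]+t≡x : ∀ x t → (x + - t) + t ≡ x
  [x-t]+t≡x = solve-∀

m+j*v≡i*u⇒m≡i*u-j*v : ∀ m i u j v → m ℕ.+ j ℕ.* v ≡ i ℕ.* u → + m ≡ + i * + u - + j * + v
m+j*v≡i*u⇒m≡i*u-j*v m i u j v eq = begin
  + m                              ≡⟨ [m+n]-n≡m (+ m) (+ j * + v) ⟨
  (+ m + + j * + v) - + j * + v    ≡⟨ cong (λ s → (+ m + s) - + j * + v) (pos-* j v) ⟨
  (+ m + + (j ℕ.* v)) - + j * + v  ≡⟨ cong (_- + j * + v) (pos-+ m (j ℕ.* v)) ⟨
  + (m ℕ.+ j ℕ.* v) - + j * + v    ≡⟨ cong (λ s → + s - + j * + v) eq ⟩
  + (i ℕ.* u) - + j * + v          ≡⟨ cong (_- + j * + v) (pos-* i u) ⟩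
  + i * + u - + j * + v            ∎
  where
  open ≡-Reasoning
  [m+n]-n≡m : ∀ m n → (m + n) - n ≡ m
  [m+n]-n≡m = solve-∀

module _ {ℓ} {P : ℤ → Set ℓ} (P-isSubgroup : IsSubgroup P) where
  open IsSubgroup P-isSubgroup

  −-closed : ∀ {s t} → P s → P t → P (s - t)
  −-closed s∈P t∈P = +-closed s∈P (neg-closed t∈P)

  +*-closed : ∀ {t} → P t → ∀ n → P (+ n * t)
  +*-closed {t} t∈P ℕ.zero    = subst P (sym (*-zeroˡ t)) contains-0
  +*-closed {t} t∈P (ℕ.suc n) = subst P (sym (suc-* (+ n) t)) (+-closed t∈P (+*-closed t∈P n))

  *-closed : ∀ {t} → P t → ∀ k → P (k * t)
  *-closed t∈P (+ n)          = +*-closed t∈P n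
  *-closed {t} t∈P -[1+ n ]   =
    subst P (neg-distribˡ-* (+ ℕ.suc n) t) (neg-closed (+*-closed t∈P (ℕ.suc n)))

  gcd-closed : ∀ {a b} → P (+ a) → P (+ b) → P (+ gcd a b)
  gcd-closed {a} {b} a∈P b∈P with Bézout.identity (gcd-GCD a b)
  ... | Bézout.+- i j eq = subst P (sym (m+j*v≡i*u⇒m≡i*u-j*v _ i a j b eq))
                             (−-closed (*-closed a∈P (+ i)) (*-closed b∈P (+ j)))
  ... | Bézout.-+ i j eq = subst P (sym (m+j*v≡i*u⇒m≡i*u-j*v _ j b i a eq))
                             (−-closed (*-closed b∈P (+ j)) (*-closed a∈P (+ i)))

  gcd∣⇒∈ : ∀ {a b t} → P (+ a) → P (+ b) → + gcd a b Signed.∣ t → P t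
  gcd∣⇒∈ a∈P b∈P (Signed.divides k eq) = subst P (sym eq) (*-closed (gcd-closed a∈P b∈P) k)

module _ (p q : ℕ) .{{_ : NonZero q}} (q<p : q <ℕ p) where
  private
    _~_ : Rel ℤ 0ℓ
    x ~ y = x ~⟨ p , q ⟩ y

  reflection-from-residues : ∀ c → (∀ z → 0ℤ ≤ z → z < + q → z ~ ((c - 1ℤ) - z)) →
                             ∀ x → x ~ ((c - 1ℤ) - x)
  reflection-from-residues c reflect x = ~-trans (gen-mod (≡-mod-residue x))
    (~-trans (reflect r (+≤+ z≤n) (+<+ (n%ℕd<d x q)))
             (gen-mod (≡-mod-by-difference x r ((c - 1ℤ) - r) ((c - 1ℤ) - x)
                        (x-r≡[c-r]-[c-x] (c - 1ℤ) r x) (≡-mod-residue x))))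
    where
    r : ℤ
    r = + (x %ℕ q)
    x-r≡[c-r]-[c-x] : ∀ c r x → x - r ≡ (c - r) - (c - x)
    x-r≡[c-r]-[c-x] = solve-∀

  reflection-q : ∀ x → x ~ ((+ q - 1ℤ) - x)
  reflection-q = reflection-from-residues (+ q) λ _ → gen-refq

  reflection-p : ∀ x → x ~ ((+ p - 1ℤ) - x)
  reflection-p = reflection-from-residues (+ p) λ z 0≤z z<q → gen-refp 0≤z (<-trans z<q (+<+ q<p))

  q-period : Period _~_ (+ q)
  q-period x = gen-mod (≡-mod-by-multiple x (x + + q) (- 1ℤ) (x-[x+q]≡-1*q x (+ q)))
    where
    x-[x+q]≡-1*q : ∀ x q → x - (x + q) ≡ - 1ℤ * q
    x-[x+q]≡-1*q = solve-∀

  p-q-period : Period _~_ (+ p - + q)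
  p-q-period x = ~-trans (reflection-q x)
    (subst (((+ q - 1ℤ) - x) ~_) (reflections-compose (+ p) (+ q) x) (reflection-p ((+ q - 1ℤ) - x)))
    where
    reflections-compose : ∀ p q x → (p - 1ℤ) - ((q - 1ℤ) - x) ≡ x + (p - q)
    reflections-compose = solve-∀

  p-period : Period _~_ (+ p)
  p-period = subst (Period _~_) ([p-q]+q≡p (+ p) (+ q)) (+-closed p-q-period q-period)
    where
    open IsSubgroup (periods-isSubgroup ~-isEquivalence)
    [p-q]+q≡p : ∀ p q → (p - q) + q ≡ p
    [p-q]+q≡p = solve-∀

  ≡-mod-gcd⇒~ : ∀ x y → x ≡ y [mod gcd p q ] → x ~ y
  ≡-mod-gcd⇒~ x y x≡y = subst (x ~_) (x+[y-x]≡y x y)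
    (gcd∣⇒∈ (periods-isSubgroup ~-isEquivalence) p-period q-period
      (≡-mod⇒∣ y x (≡-mod-sym x y x≡y)) x)
    where
    x+[y-x]≡y : ∀ x y → x + (y - x) ≡ y
    x+[y-x]≡y = solve-∀

  ≡±⇒~ : ∀ x y → x ≡± y [mod gcd p q ] → x ~ y
  ≡±⇒~ x y (inj₁ x≡y)    = ≡-mod-gcd⇒~ x y x≡y
  ≡±⇒~ x y (inj₂ x+y≡-1) = ~-trans (reflection-q x) (≡-mod-gcd⇒~ x′ y
    (reflected-trans x′ x y (reflected-sym x x′ (reflection-sum (gcd[m,n]∣n p q) x)) x+y≡-1))
    where
    x′ : ℤ
    x′ = (+ q - 1ℤ) - x

lemma5p6 : (p q : ℕ) → 0 <ℕ q → q <ℕ p → (x y : ℤ) →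
    (x ~⟨ p , q ⟩ y) ⇔ ((x ≡ y [mod gcd p q ]) ⊎ ((x + y) ≡ - 1ℤ [mod gcd p q ]))
lemma5p6 p q 0<q q<p x y =
  mk⇔ (~⇒≡± (gcd[m,n]∣m p q) (gcd[m,n]∣n p q)) (≡±⇒~ p q {{>-nonZero 0<q}} q<p x y)
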